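{- Let $\mathcal{B}$ be a connected building set on a finite set $E$, and let $T,T'$ be maximal $\mathcal{B}$-trees together with $s\neq s'\in E$ such that $s$ is a child of $s'$ in $T$, $s'$ is a child of $s$ in $T'$, and contracting the edge between $s$ and $s'$ in $T$ and in $T'$ (merging them into one vertex labeled $\{s,s'\}$) yields the same labeled rooted tree. Let $S$ (resp. $S'$) be the set of elements which are children of $s$ (resp. $s'$) in both $T$ and $T'$, $R$ the set of elements which are children of $s$ in $T$ and of $s'$ in $T'$, and $R'$ the set of elements which are children of $s'$ in $T$ and of $s$ in $T'$. For $x\in S\cup S'\cup R\cup R'$ let $D(x)=D(x,T)$ (which equals $D(x,T')$). For $X\in\{S,S',R,R'\}$ set $$\delta_X=\sum_{x\in X}|D(x)|,\qquad \pi_X=\sum_{x\neq x'\in X}|D(x)|\cdot|D(x')|.$$ Then $p(T')-p(T)=\Delta(T,T')\,(e_s-e_{s'})$, where $$\Delta(T,T')=(\delta_S+1)(\delta_{S'}+1)+\delta_{R'}(\delta_S+\delta_{S'}+\delta_R+2)+\pi_{R'}-\pi_R.$$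
   Context: A building set on $E$ is a collection $\mathcal{B}$ of non-empty subsets of $E$ closed under union of intersecting members and containing all singletons; it is connected if $E\in\mathcal{B}$. For a vertex $v$ of a rooted tree $T$ labeled by subsets of $E$, $D(v,T)$ is the union of the labels of all descendants of $v$, including $v$. A $\mathcal{B}$-tree is a rooted tree whose vertex labels partition $E$ such that $D(v,T)\in\mathcal{B}$ for every vertex $v$ and for any $k\ge2$ pairwise incomparable vertices $v_1,\dots,v_k$, $\bigcup_iD(v_i,T)\notin\mathcal{B}$. It is maximal if all labels are singletons; vertices are then identified with elements of $E$. For a maximal $\mathcal{B}$-tree $T$, $p(T)\in\mathbb{R}^E$ has coordinate $p(T)_s$ equal to the number of paths of $T$ (vertex sets of paths between unordered pairs of vertices $a,b$, with $a=b$ allowed) whose vertex closest to the root is $s$. The sum $\sum_{x\ne x'\in X}$ is over unordered pairs of distinct elements. $(e_s)$ is the standard basis of $\mathbb{R}^E$. -}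

module Defs where

open import Data.Nat using (ℕ; zero; suc; _+_; _*_; _≤_; _≤ᵇ_; _<ᵇ_)
open import Data.Integer using (ℤ; +_; -[1+_]) renaming (_-_ to _-ℤ_)
open import Data.Fin using (Fin; toℕ; _≟_) renaming (zero to fzero; suc to fsuc)
open import Data.Fin.Subset using (Subset; _∈_; _∉_; ∣_∣; ⁅_⁆; _∩_; _∪_; ⊤; Nonempty)
open import Data.Vec using (tabulate; lookup)
open import Data.Bool using (Bool; true; false; _∧_; _∨_; not; if_then_else_)
open import Data.Maybe using (Maybe; just; nothing; map)
open import Data.Product using (Σ; _×_; _,_)
open import Relation.Nullary using (¬_)
open import Relation.Nullary.Decidable using (⌊_⌋)
open import Relation.Binary.PropositionalEquality using (_≡_; _≢_)

-- E is modelled as Fin n.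

sumFin : ∀ {n} → (Fin n → ℕ) → ℕ
sumFin {zero} f = 0
sumFin {suc n} f = f fzero + sumFin (λ i → f (fsuc i))

anyFin : ∀ {n} → (Fin n → Bool) → Bool
anyFin {zero} f = false
anyFin {suc n} f = f fzero ∨ anyFin (λ i → f (fsuc i))

allFin : ∀ {n} → (Fin n → Bool) → Bool
allFin {zero} f = true
allFin {suc n} f = f fzero ∧ allFin (λ i → f (fsuc i))

anyℕ : ℕ → (ℕ → Bool) → Bool
anyℕ zero f = false
anyℕ (suc k) f = f k ∨ anyℕ k f

eqF : ∀ {n} → Fin n → Fin n → Bool
eqF x y = ⌊ x ≟ y ⌋

eqMF : ∀ {n} → Maybe (Fin n) → Fin n → Bool
eqMF nothing v = false
eqMF (just x) v = eqF x v

record IsBuildingSet {n : ℕ} (B : Subset n → Set) : Set where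
  field
    nonempty   : ∀ X → B X → Nonempty X
    singletons : ∀ x → B ⁅ x ⁆
    unionClosed : ∀ X Y → B X → B Y → Nonempty (X ∩ Y) → B (X ∪ Y)

IsConnected : ∀ {n} → (Subset n → Set) → Set
IsConnected B = B ⊤

-- Rooted trees with vertex set Fin n, given by a parent function
-- (parent v = nothing  iff  v is the root).

ParentFn : ℕ → Set
ParentFn n = Fin n → Maybe (Fin n)

up : ∀ {n} → ParentFn n → ℕ → Fin n → Maybe (Fin n)
up P zero x = just x
up P (suc k) x with up P k x
... | nothing = nothing
... | just y = P y

-- P is a rooted tree: every ancestor chain leaves the vertex set within
-- n steps (acyclicity) and there is exactly one root.
IsRootedTree : ∀ {n} → ParentFn n → Set
IsRootedTree {n} P =
  (∀ x → up P n x ≡ nothing) ×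
  Σ (Fin n) (λ r → (P r ≡ nothing) × (∀ r' → P r' ≡ nothing → r' ≡ r))

isDesc : ∀ {n} → ParentFn n → Fin n → Fin n → Bool
isDesc {n} P v x = anyℕ n (λ k → eqMF (up P k x) v)

D : ∀ {n} → ParentFn n → Fin n → Subset n
D P v = tabulate (isDesc P v)

Incomparable : ∀ {n} → ParentFn n → Fin n → Fin n → Set
Incomparable P u w = (u ∉ D P w) × (w ∉ D P u)

PairwiseIncomparable : ∀ {n} → ParentFn n → Subset n → Set
PairwiseIncomparable P V = ∀ u w → u ∈ V → w ∈ V → u ≢ w → Incomparable P u w

UnionD : ∀ {n} → ParentFn n → Subset n → Subset n
UnionD P V = tabulate (λ x → anyFin (λ v → lookup V v ∧ lookup (D P v) x))

-- maximal B-tree: vertices are the elements of E (singleton labels)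
IsMaximalBTree : ∀ {n} → (Subset n → Set) → ParentFn n → Set
IsMaximalBTree B P =
  IsRootedTree P ×
  (∀ v → B (D P v)) ×
  (∀ V → 2 ≤ ∣ V ∣ → PairwiseIncomparable P V → ¬ B (UnionD P V))

-- s is the vertex of the path a–b closest to the root (= lowest common ancestor)
isTop : ∀ {n} → ParentFn n → Fin n → Fin n → Fin n → Bool
isTop P s a b =
  lookup (D P s) a ∧ lookup (D P s) b ∧
  allFin (λ u → not (lookup (D P u) a ∧ lookup (D P u) b) ∨ lookup (D P u) s)

-- number of paths (unordered pairs {a,b}, a = b allowed) whose top vertex is s
p : ∀ {n} → ParentFn n → Fin n → ℕ
p P s = sumFin (λ a → sumFin (λ b →
          if (toℕ a ≤ᵇ toℕ b) ∧ isTop P s a b then 1 else 0))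

eDiff : ∀ {n} → Fin n → Fin n → Fin n → ℤ
eDiff s s' t = if eqF t s then + 1 else (if eqF t s' then -[1+ 0 ] else + 0)

-- Edge contraction: merging s and s' (s' is identified with s).
-- In T the edge is s → s' (s' upper), in T' it is s' → s (s upper).
-- The contracted trees coincide iff every other vertex has the same parent
-- block, and the merged vertex {s,s'} has the same parent block
-- (parent of s' in T, parent of s in T').

collapse : ∀ {n} → Fin n → Fin n → Fin n → Fin n
collapse s s' x = if eqF x s' then s else x

SameContraction : ∀ {n} → ParentFn n → ParentFn n → Fin n → Fin n → Set
SameContraction P P' s s' =
  (∀ x → x ≢ s → x ≢ s' → map (collapse s s') (P x) ≡ map (collapse s s') (P' x)) ×
  (map (collapse s s') (P s') ≡ map (collapse s s') (P' s))

isChild : ∀ {n} → ParentFn n → Fin n → Fin n → Bool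
isChild P x v = eqMF (P x) v

ChildSet : ∀ {n} → ParentFn n → ParentFn n → Fin n → Fin n → Subset n
ChildSet P P' a b = tabulate (λ x → isChild P x a ∧ isChild P' x b)

δ : ∀ {n} → ParentFn n → Subset n → ℕ
δ P X = sumFin (λ x → if lookup X x then ∣ D P x ∣ else 0)

π : ∀ {n} → ParentFn n → Subset n → ℕ
π P X = sumFin (λ x → sumFin (λ x' →
          if lookup X x ∧ lookup X x' ∧ (toℕ x <ᵇ toℕ x')
          then ∣ D P x ∣ * ∣ D P x' ∣ else 0))

Δ : ∀ {n} → ParentFn n → ParentFn n → Fin n → Fin n → ℤ
Δ P P' s s' =
  let S  = ChildSet P P' s s
      S' = ChildSet P P' s' s'
      R  = ChildSet P P' s s'
      R' = ChildSet P P' s' s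
  in + ((δ P S + 1) * (δ P S' + 1) + δ P R' * (δ P S + δ P S' + δ P R + 2) + π P R')
     -ℤ + (π P R)

module Submission where

-- For a vertex t of a rooted tree, sorting the ordered pairs of D(t) by the top vertex of the path
-- between them gives 2 p(t) + Σ |D(c)|² = |D(t)|² + 1, and |D(t)| = 1 + Σ |D(c)|, both sums over the
-- children c of t. Flipping the edge s–s′ leaves D(x) unchanged for x ∉ {s, s′}, turns D(s′, T) into
-- D(s, T′), and changes children only at s and s′: the children of s and of s′ are S ∪ R and
-- {s} ∪ S′ ∪ R′ in T, {s′} ∪ S ∪ R′ and S′ ∪ R in T′. So p(T) and p(T′) agree off {s, s′}, and the
-- identities at s and s′, combined with δ_X² = 2 π_X + Σ_{x ∈ X} |D(x)|², give Δ(T, T′) there.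

module PathCounts where

  open import Defs
  open import Data.Nat.Properties using (+-*-semiring)
  open import Algebra.Properties.Semiring.Sum +-*-semiring
    using (sum; sum-cong-≗; ∑-distrib-+; ∑-comm; *-distribˡ-sum; sum-permute)
  open import Data.Bool using (Bool; true; false; _∧_; _∨_; not; if_then_else_)
  import Data.Bool as Bool
  open import Data.Bool.Properties using (∨-zeroʳ; ∧-comm; ∧-zeroʳ; ¬-not)
  open import Data.Empty using (⊥; ⊥-elim)
  open import Data.Fin using (Fin; toℕ; _≟_) renaming (zero to fzero; suc to fsuc)
  import Data.Fin.Permutation as Perm
  import Data.Fin.Permutation.Components as PC
  open import Data.Fin.Properties using (<-cmp; <⇒≢; suc-injective)
  open import Data.Fin.Subset using (Subset; ∣_∣)
  import Data.Integer as ℤ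
  import Data.Integer.Properties as ℤ
  open import Data.Integer.Tactic.RingSolver using () renaming (solve-∀ to ℤ-solve-∀)
  open import Data.Maybe using (Maybe; just; nothing)
  import Data.Maybe as M
  open import Data.Maybe.Properties using (just-injective; map-cong; map-∘)
  import Data.Nat as ℕ
  open import Data.Nat using (ℕ; zero; suc; _+_; _*_; _∸_; _<_; _≤_; _<ᵇ_; _≤ᵇ_)
  open import Data.Nat.Properties
    using (+-identityʳ; +-comm; +-cancelʳ-≡; *-comm; *-cancelˡ-≡; *-zeroʳ; *-distribʳ-+; ≤-refl; m<n⇒m<1+n;
           ≤∧≢⇒<; m∸n+n≡m; ≮⇒≥; m≤m*n; <-irrefl; <⇒≤; <⇒≱; _<?_; _≤?_)
  open import Data.Nat.Tactic.RingSolver using (solve-∀)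
  open import Data.Product using (∃; _×_; _,_; proj₁; proj₂)
  open import Data.Sum using (_⊎_; inj₁; inj₂)
  open import Data.Vec using (tabulate; lookup)
  open import Data.Vec.Properties using (lookup∘tabulate; tabulate-cong)
  open import Function using (_∘_)
  open import Relation.Binary.Construct.Closure.ReflexiveTransitive using (Star; ε; _◅_; _◅◅_)
  open import Relation.Binary.Definitions using (tri<; tri≈; tri>)
  open import Relation.Binary.PropositionalEquality
  open import Relation.Nullary using (¬_; Dec; yes; no)
  open import Relation.Nullary.Decidable using (dec-true; dec-false; map′)

  𝟙 : Bool → ℕ
  𝟙 b = if b then 1 else 0

  if-then-0≡𝟙* : ∀ b x → (if b then x else 0) ≡ 𝟙 b * x
  if-then-0≡𝟙* true x = sym (+-identityʳ x)
  if-then-0≡𝟙* false x = refl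

  *-zeroʳ-by : ∀ x {y} → y ≡ 0 → x * y ≡ 0
  *-zeroʳ-by x refl = *-zeroʳ x

  if-∧ : ∀ x y → (if x ∧ y then 1 else 0) ≡ (if x then 𝟙 y else 0)
  if-∧ true y = refl
  if-∧ false y = refl

  𝟙-false : ∀ {b} → (b ≡ true → ⊥) → 𝟙 b ≡ 0
  𝟙-false b≢true = cong 𝟙 (¬-not b≢true)

  ≡true-ext : ∀ {x y} → (x ≡ true → y ≡ true) → (y ≡ true → x ≡ true) → x ≡ y
  ≡true-ext {true} x⇒y _ = sym (x⇒y refl)
  ≡true-ext {false} {true} _ y⇒x = y⇒x refl
  ≡true-ext {false} {false} _ _ = refl

  eqF-refl : ∀ {n} (a : Fin n) → eqF a a ≡ true
  eqF-refl a with a ≟ a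
  ... | yes _ = refl
  ... | no a≢a = ⊥-elim (a≢a refl)

  eqF-≢ : ∀ {n} {a b : Fin n} → a ≢ b → eqF a b ≡ false
  eqF-≢ {a = a} {b} a≢b with a ≟ b
  ... | yes a≡b = ⊥-elim (a≢b a≡b)
  ... | no _ = refl

  eqF-true : ∀ {n} {a b : Fin n} → eqF a b ≡ true → a ≡ b
  eqF-true {a = a} {b} h with a ≟ b
  ... | yes a≡b = a≡b

  ∧-true : ∀ {x y} → x ∧ y ≡ true → x ≡ true × y ≡ true
  ∧-true {true} {true} refl = refl , refl

  ¬∧∨-true : ∀ {x y z} → (not (x ∧ y) ∨ z) ≡ true → x ≡ true → y ≡ true → z ≡ true
  ¬∧∨-true {true} {true} h refl refl = h

  true-¬∧∨ : ∀ x y {z} → (x ≡ true → y ≡ true → z ≡ true) → (not (x ∧ y) ∨ z) ≡ true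
  true-¬∧∨ true true h = h refl refl
  true-¬∧∨ true false h = refl
  true-¬∧∨ false y h = refl

  anyℕ-true : ∀ m f → anyℕ m f ≡ true → ∃ λ k → k < m × f k ≡ true
  anyℕ-true (suc m) f h with f m in fm
  ... | true = m , ≤-refl , fm
  ... | false with anyℕ-true m f h
  ...   | k , k<m , fk = k , m<n⇒m<1+n k<m , fk

  true-anyℕ : ∀ m f {k} → k < m → f k ≡ true → anyℕ m f ≡ true
  true-anyℕ (suc m) f {k} k<1+m fk with k ℕ.≟ m
  ... | yes refl rewrite fk = refl
  ... | no k≢m rewrite true-anyℕ m f (≤∧≢⇒< (ℕ.s≤s⁻¹ k<1+m) k≢m) fk = ∨-zeroʳ (f m)

  allFin-true : ∀ {n} (f : Fin n → Bool) → allFin f ≡ true → ∀ u → f u ≡ true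
  allFin-true f h fzero = proj₁ (∧-true h)
  allFin-true f h (fsuc u) = allFin-true (f ∘ fsuc) (proj₂ (∧-true {f fzero} h)) u

  true-allFin : ∀ {n} (f : Fin n → Bool) → (∀ u → f u ≡ true) → allFin f ≡ true
  true-allFin {zero} f h = refl
  true-allFin {suc n} f h rewrite h fzero = true-allFin (f ∘ fsuc) (h ∘ fsuc)

  eqMF-true : ∀ {n} (m : Maybe (Fin n)) {v} → eqMF m v ≡ true → m ≡ just v
  eqMF-true (just x) h = cong just (eqF-true h)

  just-eqMF : ∀ {n} {m : Maybe (Fin n)} {v} → m ≡ just v → eqMF m v ≡ true
  just-eqMF {v = v} refl = eqF-refl v

  <ᵇ-true : ∀ {m n} → m < n → (m <ᵇ n) ≡ true
  <ᵇ-true {m} {n} = dec-true (m <? n)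

  <ᵇ-false : ∀ {m n} → ¬ m < n → (m <ᵇ n) ≡ false
  <ᵇ-false {m} {n} = dec-false (m <? n)

  ≤ᵇ-true : ∀ {m n} → m ≤ n → (m ≤ᵇ n) ≡ true
  ≤ᵇ-true {m} {n} = dec-true (m ≤? n)

  ≤ᵇ-false : ∀ {m n} → ¬ m ≤ n → (m ≤ᵇ n) ≡ false
  ≤ᵇ-false {m} {n} = dec-false (m ≤? n)

  sumFin≡sum : ∀ {n} (f : Fin n → ℕ) → sumFin f ≡ sum f
  sumFin≡sum {zero} f = refl
  sumFin≡sum {suc n} f = cong (f fzero +_) (sumFin≡sum (f ∘ fsuc))

  sumFin-cong : ∀ {n} {f g : Fin n → ℕ} → (∀ i → f i ≡ g i) → sumFin f ≡ sumFin g
  sumFin-cong {f = f} {g} f≗g =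
    trans (sumFin≡sum f) (trans (sum-cong-≗ {x = f} {y = g} f≗g) (sym (sumFin≡sum g)))

  sumFin-+ : ∀ {n} (f g : Fin n → ℕ) → sumFin (λ i → f i + g i) ≡ sumFin f + sumFin g
  sumFin-+ f g = begin
    sumFin (λ i → f i + g i) ≡⟨ sumFin≡sum (λ i → f i + g i) ⟩
    sum (λ i → f i + g i)    ≡⟨ ∑-distrib-+ f g ⟩
    sum f + sum g            ≡⟨ sym (cong₂ _+_ (sumFin≡sum f) (sumFin≡sum g)) ⟩
    sumFin f + sumFin g      ∎
    where open ≡-Reasoning

  sumFin-*ˡ : ∀ {n} (c : ℕ) (f : Fin n → ℕ) → sumFin (λ i → c * f i) ≡ c * sumFin f
  sumFin-*ˡ c f = begin
    sumFin (λ i → c * f i) ≡⟨ sumFin≡sum (λ i → c * f i) ⟩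
    sum (λ i → c * f i)    ≡⟨ sym (*-distribˡ-sum c f) ⟩
    c * sum f              ≡⟨ sym (cong (c *_) (sumFin≡sum f)) ⟩
    c * sumFin f           ∎
    where open ≡-Reasoning

  sumFin-zero : ∀ {n} {f : Fin n → ℕ} → (∀ i → f i ≡ 0) → sumFin f ≡ 0
  sumFin-zero {zero} f≗0 = refl
  sumFin-zero {suc n} f≗0 = cong₂ _+_ (f≗0 fzero) (sumFin-zero (f≗0 ∘ fsuc))

  sumFin-single : ∀ {n} (f : Fin n → ℕ) (a : Fin n) → (∀ i → i ≢ a → f i ≡ 0) → sumFin f ≡ f a
  sumFin-single f fzero vanish =
    trans (cong (f fzero +_) (sumFin-zero (λ i → vanish (fsuc i) λ ()))) (+-identityʳ _)
  sumFin-single f (fsuc a) vanish =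
    trans (cong (_+ sumFin (f ∘ fsuc)) (vanish fzero λ ()))
          (sumFin-single (f ∘ fsuc) a (λ i i≢a → vanish (fsuc i) (i≢a ∘ suc-injective)))

  sumFin-δ : ∀ {n} (a : Fin n) (f : Fin n → ℕ) → sumFin (λ b → if eqF a b then f b else 0) ≡ f a
  sumFin-δ a f = trans (sumFin-single _ a (λ b b≢a → cong (if_then f b else 0) (eqF-≢ (b≢a ∘ sym))))
                       (cong (if_then f a else 0) (eqF-refl a))

  sum² : ∀ {n} → (Fin n → Fin n → ℕ) → ℕ
  sum² g = sumFin (λ a → sumFin (g a))

  sum²-cong : ∀ {n} {g h : Fin n → Fin n → ℕ} → (∀ a b → g a b ≡ h a b) → sum² g ≡ sum² h
  sum²-cong g≗h = sumFin-cong (λ a → sumFin-cong (g≗h a))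

  sum²-+ : ∀ {n} (g h : Fin n → Fin n → ℕ) → sum² (λ a b → g a b + h a b) ≡ sum² g + sum² h
  sum²-+ g h = trans (sumFin-cong (λ a → sumFin-+ (g a) (h a))) (sumFin-+ (sumFin ∘ g) (sumFin ∘ h))

  sumFin-comm : ∀ {m n} (g : Fin m → Fin n → ℕ) →
    sumFin (λ a → sumFin (g a)) ≡ sumFin (λ b → sumFin (λ a → g a b))
  sumFin-comm g = begin
    sumFin (λ a → sumFin (g a))           ≡⟨ sumFin-cong (λ a → sumFin≡sum (g a)) ⟩
    sumFin (λ a → sum (g a))              ≡⟨ sumFin≡sum (λ a → sum (g a)) ⟩
    sum (λ a → sum (g a))                 ≡⟨ ∑-comm g ⟩
    sum (λ b → sum (λ a → g a b))         ≡⟨ sym (sumFin≡sum (λ b → sum (λ a → g a b))) ⟩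
    sumFin (λ b → sum (λ a → g a b))      ≡⟨ sym (sumFin-cong (λ b → sumFin≡sum (λ a → g a b))) ⟩
    sumFin (λ b → sumFin (λ a → g a b))   ∎
    where open ≡-Reasoning

  sum²-product : ∀ {n} (f g : Fin n → ℕ) → sum² (λ a b → f a * g b) ≡ sumFin f * sumFin g
  sum²-product f g = begin
    sumFin (λ a → sumFin (λ b → f a * g b)) ≡⟨ sumFin-cong (λ a → sumFin-*ˡ (f a) g) ⟩
    sumFin (λ a → f a * sumFin g)           ≡⟨ sumFin-cong (λ a → *-comm (f a) _) ⟩
    sumFin (λ a → sumFin g * f a)           ≡⟨ sumFin-*ˡ (sumFin g) f ⟩
    sumFin g * sumFin f                     ≡⟨ *-comm (sumFin g) _ ⟩
    sumFin f * sumFin g                     ∎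
    where open ≡-Reasoning

  ifLT ifLE : ∀ {n} → Fin n → Fin n → ℕ → ℕ
  ifLT a b x = if toℕ a <ᵇ toℕ b then x else 0
  ifLE a b x = if toℕ a ≤ᵇ toℕ b then x else 0

  ifEQ : ∀ {n} → Fin n → Fin n → ℕ → ℕ
  ifEQ a b x = if eqF a b then x else 0

  split-by-order : ∀ {n} (a b : Fin n) (x : ℕ) → x ≡ ifLT a b x + ifLT b a x + ifEQ a b x
  split-by-order a b x with <-cmp a b
  ... | tri< a<b _ b≮a rewrite <ᵇ-true a<b | <ᵇ-false b≮a | eqF-≢ (<⇒≢ a<b) =
    sym (trans (+-identityʳ _) (+-identityʳ x))
  ... | tri≈ _ refl _ rewrite <ᵇ-false (<-irrefl {toℕ a} refl) | eqF-refl a = refl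
  ... | tri> a≮b _ b<a rewrite <ᵇ-false a≮b | <ᵇ-true b<a | eqF-≢ (<⇒≢ b<a ∘ sym) =
    sym (+-identityʳ x)

  ifLE≡ifLT+ifEQ : ∀ {n} (a b : Fin n) (x : ℕ) → ifLE a b x ≡ ifLT a b x + ifEQ a b x
  ifLE≡ifLT+ifEQ a b x with <-cmp a b
  ... | tri< a<b _ _ rewrite ≤ᵇ-true (<⇒≤ a<b) | <ᵇ-true a<b | eqF-≢ (<⇒≢ a<b) = sym (+-identityʳ x)
  ... | tri≈ _ refl _ rewrite ≤ᵇ-true (≤-refl {toℕ a}) | <ᵇ-false (<-irrefl {toℕ a} refl) | eqF-refl a = refl
  ... | tri> a≮b _ b<a rewrite ≤ᵇ-false (<⇒≱ b<a) | <ᵇ-false a≮b | eqF-≢ (<⇒≢ b<a ∘ sym) = refl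

  sum²-diagonal : ∀ {n} (g : Fin n → Fin n → ℕ) → sum² (λ a b → ifEQ a b (g a b)) ≡ sumFin (λ a → g a a)
  sum²-diagonal g = sumFin-cong (λ a → sumFin-δ a (g a))

  sum²-by-order : ∀ {n} (g : Fin n → Fin n → ℕ) →
    sum² g ≡ sum² (λ a b → ifLT a b (g a b)) + sum² (λ a b → ifLT a b (g b a)) + sumFin (λ a → g a a)
  sum²-by-order g = begin
    sum² g
      ≡⟨ sum²-cong (λ a b → split-by-order a b (g a b)) ⟩
    sum² (λ a b → ifLT a b (g a b) + ifLT b a (g a b) + ifEQ a b (g a b))
      ≡⟨ trans (sum²-+ (λ a b → ifLT a b (g a b) + ifLT b a (g a b)) (λ a b → ifEQ a b (g a b)))
               (cong₂ _+_ (sum²-+ (λ a b → ifLT a b (g a b)) (λ a b → ifLT b a (g a b))) (sum²-diagonal g)) ⟩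
    sum² (λ a b → ifLT a b (g a b)) + sum² (λ a b → ifLT b a (g a b)) + sumFin (λ a → g a a)
      ≡⟨ cong (λ m → sum² (λ a b → ifLT a b (g a b)) + m + sumFin (λ a → g a a))
              (sumFin-comm (λ a b → ifLT b a (g a b))) ⟩
    sum² (λ a b → ifLT a b (g a b)) + sum² (λ a b → ifLT a b (g b a)) + sumFin (λ a → g a a) ∎
    where open ≡-Reasoning

  -- An unordered pair {a, b} (a = b allowed) is counted through its representative with a ≤ b.
  sum²-ifLE-symmetric : ∀ {n} (g : Fin n → Fin n → ℕ) → (∀ a b → g a b ≡ g b a) →
    2 * sum² (λ a b → ifLE a b (g a b)) ≡ sum² g + sumFin (λ a → g a a)
  sum²-ifLE-symmetric g g-sym = begin
    2 * sum² (λ a b → ifLE a b (g a b))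
      ≡⟨ cong (2 *_) (sum²-cong (λ a b → ifLE≡ifLT+ifEQ a b (g a b))) ⟩
    2 * sum² (λ a b → ifLT a b (g a b) + ifEQ a b (g a b))
      ≡⟨ cong (2 *_) (trans (sum²-+ (λ a b → ifLT a b (g a b)) (λ a b → ifEQ a b (g a b))) (cong (L +_) (sum²-diagonal g))) ⟩
    2 * (L + diag)
      ≡⟨ double L diag ⟩
    L + L + diag + diag
      ≡⟨ cong (λ m → L + m + diag + diag) (sum²-cong (λ a b → cong (ifLT a b) (g-sym a b))) ⟩
    L + sum² (λ a b → ifLT a b (g b a)) + diag + diag
      ≡⟨ cong (_+ diag) (sym (sum²-by-order g)) ⟩
    sum² g + diag ∎
    where
      open ≡-Reasoning
      L = sum² (λ a b → ifLT a b (g a b))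
      diag = sumFin (λ a → g a a)
      double : ∀ x y → 2 * (x + y) ≡ x + x + y + y
      double = solve-∀

  sum²-ifLT-product : ∀ {n} (f : Fin n → ℕ) →
    2 * sum² (λ a b → ifLT a b (f a * f b)) + sumFin (λ a → f a * f a) ≡ sumFin f * sumFin f
  sum²-ifLT-product f = begin
    2 * L + diag
      ≡⟨ twice L diag ⟩
    L + L + diag
      ≡⟨ cong (λ m → L + m + diag) (sum²-cong (λ a b → cong (ifLT a b) (*-comm (f a) (f b)))) ⟩
    L + sum² (λ a b → ifLT a b (f b * f a)) + diag
      ≡⟨ sym (sum²-by-order (λ a b → f a * f b)) ⟩
    sum² (λ a b → f a * f b)
      ≡⟨ sum²-product f f ⟩
    sumFin f * sumFin f ∎
    where
      open ≡-Reasoning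
      L = sum² (λ a b → ifLT a b (f a * f b))
      diag = sumFin (λ a → f a * f a)
      twice : ∀ x y → 2 * x + y ≡ x + x + y
      twice = solve-∀

  ∣tabulate∣ : ∀ {n} (f : Fin n → Bool) → ∣ tabulate f ∣ ≡ sumFin (𝟙 ∘ f)
  ∣tabulate∣ {zero} f = refl
  ∣tabulate∣ {suc n} f with f fzero
  ... | true = cong suc (∣tabulate∣ (f ∘ fsuc))
  ... | false = ∣tabulate∣ (f ∘ fsuc)

  sumFin-transpose : ∀ {n} (i j : Fin n) (f : Fin n → ℕ) → sumFin f ≡ sumFin (f ∘ PC.transpose i j)
  sumFin-transpose i j f = begin
    sumFin f                          ≡⟨ sumFin≡sum f ⟩
    sum f                             ≡⟨ sum-permute f (Perm.transpose i j) ⟩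
    sum (f ∘ PC.transpose i j)        ≡⟨ sym (sumFin≡sum (f ∘ PC.transpose i j)) ⟩
    sumFin (f ∘ PC.transpose i j)     ∎
    where open ≡-Reasoning

  sumWhere : ∀ {n} → (Fin n → Bool) → (Fin n → ℕ) → ℕ
  sumWhere β w = sumFin (λ c → if β c then w c else 0)

  sumFin-sumWhere : ∀ {m n} (β : Fin n → Bool) (w : Fin m → Fin n → ℕ) →
    sumFin (λ a → sumWhere β (w a)) ≡ sumWhere β (λ c → sumFin (λ a → w a c))
  sumFin-sumWhere {m} β w =
    trans (sumFin-comm (λ a c → if β c then w a c else 0)) (sumFin-cong pull-if)
    where
      pull-if : ∀ c → sumFin (λ a → if β c then w a c else 0) ≡ (if β c then sumFin (λ a → w a c) else 0)
      pull-if c with β c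
      ... | true = refl
      ... | false = sumFin-zero {m} (λ _ → refl)

  sum²-sumWhere : ∀ {m n} (β : Fin n → Bool) (w : Fin m → Fin m → Fin n → ℕ) →
    sum² (λ a b → sumWhere β (w a b)) ≡ sumWhere β (λ c → sum² (λ a b → w a b c))
  sum²-sumWhere β w =
    trans (sumFin-cong (λ a → sumFin-sumWhere β (w a))) (sumFin-sumWhere β (λ a c → sumFin (λ b → w a b c)))

  sumWhere-𝟙* : ∀ {n} (β : Fin n → Bool) (w : Fin n → ℕ) → sumWhere β w ≡ sumFin (λ c → 𝟙 (β c) * w c)
  sumWhere-𝟙* β w = sumFin-cong (λ c → if-then-0≡𝟙* (β c) (w c))

  sumWhere-split : ∀ {n} {β β₁ β₂ : Fin n → Bool} (w : Fin n → ℕ) →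
    (∀ c → 𝟙 (β c) ≡ 𝟙 (β₁ c) + 𝟙 (β₂ c)) → sumWhere β w ≡ sumWhere β₁ w + sumWhere β₂ w
  sumWhere-split {β = β} {β₁} {β₂} w split = begin
    sumWhere β w
      ≡⟨ sumWhere-𝟙* β w ⟩
    sumFin (λ c → 𝟙 (β c) * w c)
      ≡⟨ sumFin-cong (λ c → trans (cong (_* w c) (split c)) (*-distribʳ-+ (w c) (𝟙 (β₁ c)) (𝟙 (β₂ c)))) ⟩
    sumFin (λ c → 𝟙 (β₁ c) * w c + 𝟙 (β₂ c) * w c)
      ≡⟨ sumFin-+ (λ c → 𝟙 (β₁ c) * w c) (λ c → 𝟙 (β₂ c) * w c) ⟩
    sumFin (λ c → 𝟙 (β₁ c) * w c) + sumFin (λ c → 𝟙 (β₂ c) * w c)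
      ≡⟨ sym (cong₂ _+_ (sumWhere-𝟙* β₁ w) (sumWhere-𝟙* β₂ w)) ⟩
    sumWhere β₁ w + sumWhere β₂ w ∎
    where open ≡-Reasoning

  sumWhere-split₃ : ∀ {n} {β β₀ β₁ β₂ : Fin n → Bool} (w : Fin n → ℕ) →
    (∀ c → 𝟙 (β c) ≡ 𝟙 (β₀ c) + 𝟙 (β₁ c) + 𝟙 (β₂ c)) →
    sumWhere β w ≡ sumWhere β₀ w + sumWhere β₁ w + sumWhere β₂ w
  sumWhere-split₃ {β = β} {β₀} {β₁} {β₂} w split = begin
    sumWhere β w
      ≡⟨ sumWhere-𝟙* β w ⟩
    sumFin (λ c → 𝟙 (β c) * w c)
      ≡⟨ sumFin-cong (λ c → trans (cong (_* w c) (split c)) (distrib (𝟙 (β₀ c)) (𝟙 (β₁ c)) (𝟙 (β₂ c)) (w c))) ⟩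
    sumFin (λ c → 𝟙 (β₀ c) * w c + 𝟙 (β₁ c) * w c + 𝟙 (β₂ c) * w c)
      ≡⟨ trans (sumFin-+ (λ c → 𝟙 (β₀ c) * w c + 𝟙 (β₁ c) * w c) (λ c → 𝟙 (β₂ c) * w c))
               (cong (_+ sumFin (λ c → 𝟙 (β₂ c) * w c)) (sumFin-+ (λ c → 𝟙 (β₀ c) * w c) (λ c → 𝟙 (β₁ c) * w c))) ⟩
    sumFin (λ c → 𝟙 (β₀ c) * w c) + sumFin (λ c → 𝟙 (β₁ c) * w c) + sumFin (λ c → 𝟙 (β₂ c) * w c)
      ≡⟨ sym (cong₂ _+_ (cong₂ _+_ (sumWhere-𝟙* β₀ w) (sumWhere-𝟙* β₁ w)) (sumWhere-𝟙* β₂ w)) ⟩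
    sumWhere β₀ w + sumWhere β₁ w + sumWhere β₂ w ∎
    where
      open ≡-Reasoning
      distrib : ∀ x y z v → (x + y + z) * v ≡ x * v + y * v + z * v
      distrib = solve-∀

  childSum : ∀ {n} → ParentFn n → Fin n → (Fin n → ℕ) → ℕ
  childSum P t = sumWhere (λ c → isChild P c t)

  -- π counts unordered pairs of distinct elements, δ² counts ordered pairs.
  δ²≡2π+squares : ∀ {n} (P : ParentFn n) (X : Subset n) →
    2 * π P X + sumWhere (lookup X) (λ c → ∣ D P c ∣ * ∣ D P c ∣) ≡ δ P X * δ P X
  δ²≡2π+squares P X = begin
    2 * π P X + sumWhere (lookup X) (λ c → ∣ D P c ∣ * ∣ D P c ∣)
      ≡⟨ cong₂ (λ m k → 2 * m + k) (sum²-cong (λ a b → pair (lookup X a) (lookup X b) (toℕ a <ᵇ toℕ b)))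
                                     (sumFin-cong (λ c → square (lookup X c))) ⟩
    2 * sum² (λ a b → ifLT a b (f a * f b)) + sumFin (λ c → f c * f c)
      ≡⟨ sum²-ifLT-product f ⟩
    δ P X * δ P X ∎
    where
      open ≡-Reasoning
      f : Fin _ → ℕ
      f c = if lookup X c then ∣ D P c ∣ else 0
      pair : ∀ {u v} x y z → (if x ∧ y ∧ z then u * v else 0) ≡ (if z then (if x then u else 0) * (if y then v else 0) else 0)
      pair {u} true true true = refl
      pair {u} true false true = sym (*-zeroʳ u)
      pair false y true = refl
      pair true true false = refl
      pair true false false = refl
      pair false y false = refl
      square : ∀ {u} x → (if x then u * u else 0) ≡ (if x then u else 0) * (if x then u else 0)
      square true = refl
      square false = refl

  Acyclic : ∀ {n} → ParentFn n → Set
  Acyclic {n} P = ∀ x → up P n x ≡ nothing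

  module Ancestry {n : ℕ} (P : ParentFn n) where

    ParentOf : Fin n → Fin n → Set
    ParentOf a y = P a ≡ just y

    -- a ≼ v : a lies in the subtree rooted at v.
    infix 4 _≼_
    _≼_ : Fin n → Fin n → Set
    _≼_ = Star ParentOf

    up-suc : ∀ k x → up P (suc k) x ≡ (up P k x M.>>= P)
    up-suc k x with up P k x
    ... | nothing = refl
    ... | just y = refl

    up-suc′ : ∀ k x → up P (suc k) x ≡ (P x M.>>= up P k)
    up-suc′ zero x with P x
    ... | nothing = refl
    ... | just y = refl
    up-suc′ (suc k) x = begin
      up P (suc (suc k)) x            ≡⟨ up-suc (suc k) x ⟩
      (up P (suc k) x M.>>= P)        ≡⟨ cong (M._>>= P) (up-suc′ k x) ⟩
      ((P x M.>>= up P k) M.>>= P)    ≡⟨ assoc (P x) ⟩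
      (P x M.>>= up P (suc k))        ∎
      where
        open ≡-Reasoning
        assoc : ∀ m → ((m M.>>= up P k) M.>>= P) ≡ (m M.>>= up P (suc k))
        assoc nothing = refl
        assoc (just y) = sym (up-suc k y)

    up⇒≼ : ∀ k {a v} → up P k a ≡ just v → a ≼ v
    up⇒≼ zero refl = ε
    up⇒≼ (suc k) {a} {v} h with up P k a in e
    ... | just y = up⇒≼ k e ◅◅ (h ◅ ε)

    ≼⇒up : ∀ {a v} → a ≼ v → ∃ λ k → up P k a ≡ just v
    ≼⇒up ε = 0 , refl
    ≼⇒up {a} (a→y ◅ y≼v) with ≼⇒up y≼v
    ... | k , h = suc k , trans (up-suc′ k a) (trans (cong (M._>>= up P k) a→y) h)

    ≼-child : ∀ {a t} → a ≼ t → a ≡ t ⊎ ∃ λ c → ParentOf c t × a ≼ c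
    ≼-child ε = inj₁ refl
    ≼-child (a→y ◅ y≼t) with ≼-child y≼t
    ... | inj₁ refl = inj₂ (_ , a→y , ε)
    ... | inj₂ (c , c→t , y≼c) = inj₂ (c , c→t , a→y ◅ y≼c)

    ≼-total : ∀ {a u v} → a ≼ u → a ≼ v → u ≼ v ⊎ v ≼ u
    ≼-total ε a≼v = inj₁ a≼v
    ≼-total a≼u@(_ ◅ _) ε = inj₂ a≼u
    ≼-total (a→y ◅ y≼u) (a→y′ ◅ y′≼v) with just-injective (trans (sym a→y) a→y′)
    ... | refl = ≼-total y≼u y′≼v

    up-+ : ∀ j k {x y} → up P k x ≡ just y → up P (j + k) x ≡ up P j y
    up-+ zero k h = h
    up-+ (suc j) k {x} {y} h =
      trans (up-suc (j + k) x) (trans (cong (M._>>= P) (up-+ j k h)) (sym (up-suc j y)))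

    up-nothing : ∀ j k {x} → up P k x ≡ nothing → up P (j + k) x ≡ nothing
    up-nothing zero k h = h
    up-nothing (suc j) k {x} h = trans (up-suc (j + k) x) (cong (M._>>= P) (up-nothing j k h))

  module Forest {n : ℕ} {P : ParentFn n} (acyclic : Acyclic P) where

    open Ancestry P public

    up-bounded : ∀ {k a v} → up P k a ≡ just v → k < n
    up-bounded {k} {a} h with k <? n
    ... | yes k<n = k<n
    ... | no k≮n with () ← trans (sym h) (trans (cong (λ j → up P j a) (sym (m∸n+n≡m (≮⇒≥ k≮n))))
                                                (up-nothing (k ∸ n) n (acyclic a)))

    no-cycle : ∀ {a y} → ParentOf a y → y ≼ a → ⊥
    no-cycle {a} a→y y≼a = <⇒≱ (up-bounded (iterate n)) (m≤m*n n (suc k))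
      where
        k = proj₁ (≼⇒up y≼a)
        cycle : up P (suc k) a ≡ just a
        cycle = proj₂ (≼⇒up (a→y ◅ y≼a))
        iterate : ∀ j → up P (j * suc k) a ≡ just a
        iterate zero = refl
        iterate (suc j) = trans (up-+ (suc k) (j * suc k) (iterate j)) cycle

    ≼-antisym : ∀ {a v} → a ≼ v → v ≼ a → a ≡ v
    ≼-antisym ε _ = refl
    ≼-antisym (a→y ◅ y≼v) v≼a = ⊥-elim (no-cycle a→y (y≼v ◅◅ v≼a))

    sibling-≼ : ∀ {c c′ t} → ParentOf c t → ParentOf c′ t → c ≼ c′ → c ≡ c′
    sibling-≼ _ _ ε = refl
    sibling-≼ c→t c′→t (c→y ◅ y≼c′) with just-injective (trans (sym c→t) c→y)
    ... | refl = ⊥-elim (no-cycle c′→t y≼c′)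

    siblings-disjoint : ∀ {a c c′ t} → ParentOf c t → ParentOf c′ t → a ≼ c → a ≼ c′ → c ≡ c′
    siblings-disjoint c→t c′→t a≼c a≼c′ with ≼-total a≼c a≼c′
    ... | inj₁ c≼c′ = sibling-≼ c→t c′→t c≼c′
    ... | inj₂ c′≼c = sym (sibling-≼ c′→t c→t c′≼c)

    isDesc⇒≼ : ∀ {v a} → isDesc P v a ≡ true → a ≼ v
    isDesc⇒≼ {v} {a} h with anyℕ-true n (λ k → eqMF (up P k a) v) h
    ... | k , _ , e = up⇒≼ k (eqMF-true (up P k a) e)

    ≼⇒isDesc : ∀ {v a} → a ≼ v → isDesc P v a ≡ true
    ≼⇒isDesc {v} {a} a≼v with ≼⇒up a≼v
    ... | k , h = true-anyℕ n (λ k → eqMF (up P k a) v) {k} (up-bounded h) (just-eqMF h)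

    ∈D⇒≼ : ∀ {v a} → lookup (D P v) a ≡ true → a ≼ v
    ∈D⇒≼ {v} {a} h = isDesc⇒≼ (trans (sym (lookup∘tabulate (isDesc P v) a)) h)

    ≼⇒∈D : ∀ {v a} → a ≼ v → lookup (D P v) a ≡ true
    ≼⇒∈D {v} {a} a≼v = trans (lookup∘tabulate (isDesc P v) a) (≼⇒isDesc a≼v)

    IsTop : Fin n → Fin n → Fin n → Set
    IsTop t a b = a ≼ t × b ≼ t × (∀ u → a ≼ u → b ≼ u → t ≼ u)

    isTop⇒IsTop : ∀ {t a b} → isTop P t a b ≡ true → IsTop t a b
    isTop⇒IsTop {t} {a} {b} h with ∧-true h
    ... | a∈Dt , h′ with ∧-true h′
    ...   | b∈Dt , lowest =
      ∈D⇒≼ a∈Dt , ∈D⇒≼ b∈Dt ,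
      λ u a≼u b≼u → ∈D⇒≼ (¬∧∨-true (allFin-true _ lowest u) (≼⇒∈D a≼u) (≼⇒∈D b≼u))

    IsTop⇒isTop : ∀ {t a b} → IsTop t a b → isTop P t a b ≡ true
    IsTop⇒isTop {t} {a} {b} (a≼t , b≼t , lowest) rewrite ≼⇒∈D a≼t | ≼⇒∈D b≼t =
      true-allFin _ (λ u → true-¬∧∨ (lookup (D P u) a) (lookup (D P u) b)
                                    (λ a∈Du b∈Du → ≼⇒∈D (lowest u (∈D⇒≼ a∈Du) (∈D⇒≼ b∈Du))))

    𝟙-isDesc-1 : ∀ {v a} → a ≼ v → 𝟙 (isDesc P v a) ≡ 1
    𝟙-isDesc-1 a≼v = cong 𝟙 (≼⇒isDesc a≼v)

    𝟙-isDesc-0 : ∀ {v a} → ¬ a ≼ v → 𝟙 (isDesc P v a) ≡ 0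
    𝟙-isDesc-0 a⋠v = 𝟙-false (a⋠v ∘ isDesc⇒≼)

    _≼?_ : ∀ a v → Dec (a ≼ v)
    a ≼? v = map′ isDesc⇒≼ ≼⇒isDesc (isDesc P v a Bool.≟ true)

    childSum-none : ∀ {t} (w : Fin n → ℕ) → (∀ c → ParentOf c t → w c ≡ 0) → childSum P t w ≡ 0
    childSum-none {t} w vanish = sumFin-zero term
      where
        term : ∀ c → (if isChild P c t then w c else 0) ≡ 0
        term c with isChild P c t in e
        ... | true = vanish c (eqMF-true (P c) e)
        ... | false = refl

    childSum-unique : ∀ {c t} (w : Fin n → ℕ) → ParentOf c t →
      (∀ c′ → ParentOf c′ t → c′ ≢ c → w c′ ≡ 0) → childSum P t w ≡ w c
    childSum-unique {c} {t} w c→t vanish =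
      trans (sumFin-single _ c other) (cong (if_then w c else 0) (just-eqMF c→t))
      where
        other : ∀ c′ → c′ ≢ c → (if isChild P c′ t then w c′ else 0) ≡ 0
        other c′ c′≢c with isChild P c′ t in e
        ... | true = vanish c′ (eqMF-true (P c′) e) c′≢c
        ... | false = refl

    -- D(t) is {t} together with the disjoint subtrees of the children of t.
    𝟙-isDesc-children : ∀ t a → 𝟙 (isDesc P t a) ≡ 𝟙 (eqF t a) + childSum P t (λ c → 𝟙 (isDesc P c a))
    𝟙-isDesc-children t a with a ≟ t
    ... | yes refl = trans (𝟙-isDesc-1 ε)
      (sym (cong₂ _+_ (cong 𝟙 (eqF-refl t)) (childSum-none _ (λ c c→t → 𝟙-isDesc-0 (no-cycle c→t)))))
    ... | no a≢t rewrite eqF-≢ (a≢t ∘ sym) with a ≼? t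
    ...   | no a⋠t = trans (𝟙-isDesc-0 a⋠t)
      (sym (childSum-none _ (λ c c→t → 𝟙-isDesc-0 (λ a≼c → a⋠t (a≼c ◅◅ (c→t ◅ ε))))))
    ...   | yes a≼t with ≼-child a≼t
    ...     | inj₁ a≡t = ⊥-elim (a≢t a≡t)
    ...     | inj₂ (c , c→t , a≼c) = trans (𝟙-isDesc-1 a≼t) (sym (trans
      (childSum-unique _ c→t (λ c′ c′→t c′≢c → 𝟙-isDesc-0 (λ a≼c′ → c′≢c (siblings-disjoint c′→t c→t a≼c′ a≼c))))
      (𝟙-isDesc-1 a≼c)))

    ∣D∣≡ : ∀ v → ∣ D P v ∣ ≡ sumFin (λ a → 𝟙 (isDesc P v a))
    ∣D∣≡ v = ∣tabulate∣ (isDesc P v)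

    subtree-size : ∀ t → ∣ D P t ∣ ≡ 1 + childSum P t (λ c → ∣ D P c ∣)
    subtree-size t = begin
      ∣ D P t ∣
        ≡⟨ ∣D∣≡ t ⟩
      sumFin (λ a → 𝟙 (isDesc P t a))
        ≡⟨ sumFin-cong (𝟙-isDesc-children t) ⟩
      sumFin (λ a → 𝟙 (eqF t a) + childSum P t (λ c → 𝟙 (isDesc P c a)))
        ≡⟨ sumFin-+ (λ a → 𝟙 (eqF t a)) (λ a → childSum P t (λ c → 𝟙 (isDesc P c a))) ⟩
      sumFin (λ a → 𝟙 (eqF t a)) + sumFin (λ a → childSum P t (λ c → 𝟙 (isDesc P c a)))
        ≡⟨ cong₂ _+_ (sumFin-δ t (λ _ → 1)) (sumFin-sumWhere _ (λ a c → 𝟙 (isDesc P c a))) ⟩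
      1 + childSum P t (λ c → sumFin (λ a → 𝟙 (isDesc P c a)))
        ≡⟨ cong (1 +_) (sumFin-cong (λ c → cong (if isChild P c t then_else 0) (sym (∣D∣≡ c)))) ⟩
      1 + childSum P t (λ c → ∣ D P c ∣) ∎
      where open ≡-Reasoning

    IsTop-swap : ∀ {t a b} → IsTop t a b → IsTop t b a
    IsTop-swap (a≼t , b≼t , lowest) = b≼t , a≼t , λ u b≼u a≼u → lowest u a≼u b≼u

    isTop-sym : ∀ t a b → isTop P t a b ≡ isTop P t b a
    isTop-sym t a b = ≡true-ext (IsTop⇒isTop ∘ IsTop-swap ∘ isTop⇒IsTop) (IsTop⇒isTop ∘ IsTop-swap ∘ isTop⇒IsTop)

    𝟙-isTop-0 : ∀ {t a b} → ¬ IsTop t a b → 𝟙 (isTop P t a b) ≡ 0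
    𝟙-isTop-0 ¬top = 𝟙-false (¬top ∘ isTop⇒IsTop)

    𝟙-isTop-1 : ∀ {t a b} → IsTop t a b → 𝟙 (isTop P t a b) ≡ 1
    𝟙-isTop-1 top = cong 𝟙 (IsTop⇒isTop top)

    IsTop-self : ∀ {t a} → IsTop t a a → a ≡ t
    IsTop-self (a≼t , _ , lowest) = ≼-antisym a≼t (lowest _ ε ε)

    IsTop-in-different-children : ∀ {t a b ca cb} → ParentOf ca t → ParentOf cb t → a ≼ ca → b ≼ cb → ca ≢ cb →
      IsTop t a b
    IsTop-in-different-children {t} {a} {b} ca→t cb→t a≼ca b≼cb ca≢cb =
      a≼t , b≼t , lowest
      where
        a≼t = a≼ca ◅◅ (ca→t ◅ ε)
        b≼t = b≼cb ◅◅ (cb→t ◅ ε)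
        lowest : ∀ u → a ≼ u → b ≼ u → t ≼ u
        lowest u a≼u b≼u with ≼-total a≼u a≼t
        ... | inj₂ t≼u = t≼u
        ... | inj₁ u≼t with ≼-child u≼t
        ...   | inj₁ refl = ε
        ...   | inj₂ (c , c→t , u≼c) = ⊥-elim (ca≢cb (trans
          (siblings-disjoint ca→t c→t a≼ca (a≼u ◅◅ u≼c)) (siblings-disjoint c→t cb→t (b≼u ◅◅ u≼c) b≼cb)))

    ¬IsTop-in-child : ∀ {t a b c} → ParentOf c t → a ≼ c → b ≼ c → ¬ IsTop t a b
    ¬IsTop-in-child c→t a≼c b≼c (_ , _ , lowest) = no-cycle c→t (lowest _ a≼c b≼c)

    -- A pair (a, b) in D(t) × D(t) either has top t or lies in the subtree of a single child of t.
    𝟙-isTop-children : ∀ t a b →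
      𝟙 (isDesc P t a) * 𝟙 (isDesc P t b) ≡
      𝟙 (isTop P t a b) + childSum P t (λ c → 𝟙 (isDesc P c a) * 𝟙 (isDesc P c b))
    𝟙-isTop-children t a b with a ≼? t | b ≼? t
    ... | no a⋠t | _ rewrite 𝟙-isDesc-0 a⋠t = sym (cong₂ _+_
      (𝟙-isTop-0 (a⋠t ∘ proj₁))
      (childSum-none _ (λ c c→t → cong (_* _) (𝟙-isDesc-0 (λ a≼c → a⋠t (a≼c ◅◅ (c→t ◅ ε)))))))
    ... | yes a≼t | no b⋠t rewrite 𝟙-isDesc-1 a≼t | 𝟙-isDesc-0 b⋠t = sym (cong₂ _+_
      (𝟙-isTop-0 (b⋠t ∘ proj₁ ∘ proj₂))
      (childSum-none _ (λ c c→t → *-zeroʳ-by (𝟙 (isDesc P c a)) (𝟙-isDesc-0 (λ b≼c → b⋠t (b≼c ◅◅ (c→t ◅ ε)))))))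
    ... | yes a≼t | yes b≼t rewrite 𝟙-isDesc-1 a≼t | 𝟙-isDesc-1 b≼t with ≼-child a≼t | ≼-child b≼t
    ...   | inj₁ refl | _ = sym (cong₂ _+_
      (𝟙-isTop-1 (ε , b≼t , λ _ t≼u _ → t≼u))
      (childSum-none _ (λ c c→t → cong (_* _) (𝟙-isDesc-0 (no-cycle c→t)))))
    ...   | inj₂ _ | inj₁ refl = sym (cong₂ _+_
      (𝟙-isTop-1 (a≼t , ε , λ _ _ t≼u → t≼u))
      (childSum-none _ (λ c c→t → *-zeroʳ-by (𝟙 (isDesc P c a)) (𝟙-isDesc-0 (no-cycle c→t)))))
    ...   | inj₂ (ca , ca→t , a≼ca) | inj₂ (cb , cb→t , b≼cb) with ca ≟ cb
    ...     | yes refl = sym (cong₂ _+_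
      (𝟙-isTop-0 (¬IsTop-in-child ca→t a≼ca b≼cb))
      (trans (childSum-unique _ ca→t (λ c c→t c≢ca → cong (_* _) (𝟙-isDesc-0 (λ a≼c → c≢ca (siblings-disjoint c→t ca→t a≼c a≼ca)))))
             (cong₂ _*_ (𝟙-isDesc-1 a≼ca) (𝟙-isDesc-1 b≼cb))))
    ...     | no ca≢cb = sym (cong₂ _+_
      (𝟙-isTop-1 (IsTop-in-different-children ca→t cb→t a≼ca b≼cb ca≢cb))
      (childSum-none _ (λ c c→t → 𝟙-pair-0 c c→t)))
      where
        𝟙-pair-0 : ∀ c → ParentOf c t → 𝟙 (isDesc P c a) * 𝟙 (isDesc P c b) ≡ 0
        𝟙-pair-0 c c→t with a ≼? c
        ... | no a⋠c = cong (_* _) (𝟙-isDesc-0 a⋠c)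
        ... | yes a≼c = *-zeroʳ-by (𝟙 (isDesc P c a)) (𝟙-isDesc-0 λ b≼c → ca≢cb (trans
          (siblings-disjoint ca→t c→t a≼ca a≼c) (siblings-disjoint c→t cb→t b≼c b≼cb)))

    ∣D∣²≡ : ∀ v → ∣ D P v ∣ * ∣ D P v ∣ ≡ sum² (λ a b → 𝟙 (isDesc P v a) * 𝟙 (isDesc P v b))
    ∣D∣²≡ v = trans (cong₂ _*_ (∣D∣≡ v) (∣D∣≡ v)) (sym (sum²-product (𝟙 ∘ isDesc P v) (𝟙 ∘ isDesc P v)))

    ordered-tops : ∀ t →
      sum² (λ a b → 𝟙 (isTop P t a b)) + childSum P t (λ c → ∣ D P c ∣ * ∣ D P c ∣) ≡ ∣ D P t ∣ * ∣ D P t ∣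
    ordered-tops t = begin
      sum² top + childSum P t (λ c → ∣ D P c ∣ * ∣ D P c ∣)
        ≡⟨ cong (sum² top +_) (sumFin-cong (λ c → cong (if isChild P c t then_else 0) (∣D∣²≡ c))) ⟩
      sum² top + childSum P t (λ c → sum² (λ a b → inside c a b))
        ≡⟨ cong (sum² top +_) (sym (sum²-sumWhere _ (λ a b c → inside c a b))) ⟩
      sum² top + sum² (λ a b → childSum P t (λ c → inside c a b))
        ≡⟨ sym (sum²-+ top (λ a b → childSum P t (λ c → inside c a b))) ⟩
      sum² (λ a b → top a b + childSum P t (λ c → inside c a b))
        ≡⟨ sym (sum²-cong (𝟙-isTop-children t)) ⟩
      sum² (inside t)
        ≡⟨ sym (∣D∣²≡ t) ⟩
      ∣ D P t ∣ * ∣ D P t ∣ ∎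
      where
        open ≡-Reasoning
        top : Fin n → Fin n → ℕ
        top a b = 𝟙 (isTop P t a b)
        inside : Fin n → Fin n → Fin n → ℕ
        inside c a b = 𝟙 (isDesc P c a) * 𝟙 (isDesc P c b)

    diagonal-tops : ∀ t → sumFin (λ a → 𝟙 (isTop P t a a)) ≡ 1
    diagonal-tops t = trans
      (sumFin-single _ t (λ a a≢t → 𝟙-isTop-0 (a≢t ∘ IsTop-self)))
      (𝟙-isTop-1 (ε , ε , λ _ t≼u _ → t≼u))

    path-count : ∀ t → 2 * p P t + childSum P t (λ c → ∣ D P c ∣ * ∣ D P c ∣) ≡ ∣ D P t ∣ * ∣ D P t ∣ + 1
    path-count t = begin
      2 * p P t + C
        ≡⟨ cong (λ m → 2 * m + C) (sum²-cong (λ a b → if-∧ (toℕ a ≤ᵇ toℕ b) (isTop P t a b))) ⟩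
      2 * sum² (λ a b → ifLE a b (𝟙 (isTop P t a b))) + C
        ≡⟨ cong (_+ C) (sum²-ifLE-symmetric _ (λ a b → cong 𝟙 (isTop-sym t a b))) ⟩
      sum² (λ a b → 𝟙 (isTop P t a b)) + sumFin (λ a → 𝟙 (isTop P t a a)) + C
        ≡⟨ cong (λ m → sum² (λ a b → 𝟙 (isTop P t a b)) + m + C) (diagonal-tops t) ⟩
      sum² (λ a b → 𝟙 (isTop P t a b)) + 1 + C
        ≡⟨ +-comm-last (sum² (λ a b → 𝟙 (isTop P t a b))) 1 C ⟩
      sum² (λ a b → 𝟙 (isTop P t a b)) + C + 1
        ≡⟨ cong (_+ 1) (ordered-tops t) ⟩
      ∣ D P t ∣ * ∣ D P t ∣ + 1 ∎
      where
        open ≡-Reasoning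
        C = childSum P t (λ c → ∣ D P c ∣ * ∣ D P c ∣)
        +-comm-last : ∀ x y z → x + y + z ≡ x + z + y
        +-comm-last = solve-∀

  not-child : ∀ {n} (Q : ParentFn n) {c v} → (Q c ≡ just v → ⊥) → isChild Q c v ≡ false
  not-child Q {c} ¬c→v = ¬-not (¬c→v ∘ eqMF-true (Q c))

  collapse-s′ : ∀ {n} {s s′ : Fin n} → collapse s s′ s′ ≡ s
  collapse-s′ {s′ = s′} rewrite eqF-refl s′ = refl

  collapse-≢ : ∀ {n} {s s′ x : Fin n} → x ≢ s′ → collapse s s′ x ≡ x
  collapse-≢ x≢s′ rewrite eqF-≢ x≢s′ = refl

  collapse-s : ∀ {n} {s s′ : Fin n} → collapse s s′ s ≡ s
  collapse-s {s = s} {s′} with eqF s s′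
  ... | true = refl
  ... | false = refl

  collapse-≡ : ∀ {n} {s s′ z t : Fin n} → collapse s s′ z ≡ t → t ≢ s → z ≡ t
  collapse-≡ {s′ = s′} {z} refl t≢s with eqF z s′
  ... | true = ⊥-elim (t≢s refl)
  ... | false = refl

  collapse-back : ∀ {n} {s s′ : Fin n} x → collapse s′ s (collapse s s′ x) ≡ collapse s′ s x
  collapse-back {s = s} {s′} x with eqF x s′ in e
  ... | false = refl
  ... | true with refl ← eqF-true e rewrite eqF-refl s = sym (collapse-s {s = s′} {s})

  map-collapse-back : ∀ {n} {s s′ : Fin n} (m m′ : Maybe (Fin n)) →
    M.map (collapse s s′) m ≡ M.map (collapse s s′) m′ → M.map (collapse s′ s) m ≡ M.map (collapse s′ s) m′
  map-collapse-back {s = s} {s′} m m′ e = begin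
    M.map (collapse s′ s) m                          ≡⟨ sym (map-cong collapse-back m) ⟩
    M.map (collapse s′ s ∘ collapse s s′) m          ≡⟨ map-∘ m ⟩
    M.map (collapse s′ s) (M.map (collapse s s′) m)  ≡⟨ cong (M.map (collapse s′ s)) e ⟩
    M.map (collapse s′ s) (M.map (collapse s s′) m′) ≡⟨ sym (map-∘ m′) ⟩
    M.map (collapse s′ s ∘ collapse s s′) m′         ≡⟨ map-cong collapse-back m′ ⟩
    M.map (collapse s′ s) m′                         ∎
    where open ≡-Reasoning

  SameContraction-sym : ∀ {n} {P P′ : ParentFn n} {s s′} → SameContraction P P′ s s′ → SameContraction P′ P s′ s
  SameContraction-sym {P = P} {P′} {s} {s′} (same , same-merged) =
    (λ x x≢s′ x≢s → map-collapse-back {s = s} (P′ x) (P x) (sym (same x x≢s x≢s′))) ,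
    map-collapse-back {s = s} (P′ s) (P s′) (sym same-merged)

  collapse-parent : ∀ {n} {s s′ t : Fin n} {m m′ : Maybe (Fin n)} →
    M.map (collapse s s′) m ≡ M.map (collapse s s′) m′ → t ≢ s → t ≢ s′ → m ≡ just t → m′ ≡ just t
  collapse-parent {m′ = just z} e t≢s t≢s′ refl =
    cong just (collapse-≡ (trans (sym (just-injective e)) (collapse-≢ t≢s′)) t≢s)

  isChild-collapse : ∀ {n} {s s′ t : Fin n} (m m′ : Maybe (Fin n)) →
    M.map (collapse s s′) m ≡ M.map (collapse s s′) m′ → t ≢ s → t ≢ s′ → eqMF m t ≡ eqMF m′ t
  isChild-collapse m m′ e t≢s t≢s′ = ≡true-ext
    (λ h → just-eqMF (collapse-parent {m = m} {m′} e t≢s t≢s′ (eqMF-true m h)))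
    (λ h → just-eqMF (collapse-parent {m = m′} {m} (sym e) t≢s t≢s′ (eqMF-true m′ h)))

  𝟙-merged : ∀ {n} {s s′ : Fin n} → s ≢ s′ → ∀ m →
    𝟙 (eqMF m s) + 𝟙 (eqMF m s′) ≡ 𝟙 (eqMF (M.map (collapse s s′) m) s)
  𝟙-merged s≢s′ nothing = refl
  𝟙-merged {s = s} {s′} s≢s′ (just z) with eqF z s′ in e
  ... | false = +-identityʳ _
  ... | true with refl ← eqF-true e rewrite eqF-≢ (s≢s′ ∘ sym) | eqF-refl s = refl

  -- Refining a partition {x₁, x₂} of a set by another partition {y₁, y₂} of the same set.
  refineˡ : ∀ x₁ x₂ y₁ y₂ {z} → 𝟙 x₁ + 𝟙 x₂ ≡ 𝟙 z → 𝟙 y₁ + 𝟙 y₂ ≡ 𝟙 z →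
    𝟙 x₁ ≡ 𝟙 (x₁ ∧ y₁) + 𝟙 (x₁ ∧ y₂)
  refineˡ false _ _ _ _ _ = refl
  refineˡ true _ _ _ {true} _ y₁+y₂≡1 = sym y₁+y₂≡1

  refineʳ : ∀ x₁ x₂ y₁ y₂ {z} → 𝟙 x₁ + 𝟙 x₂ ≡ 𝟙 z → 𝟙 y₁ + 𝟙 y₂ ≡ 𝟙 z →
    𝟙 y₁ ≡ 𝟙 (x₁ ∧ y₁) + 𝟙 (x₂ ∧ y₁)
  refineʳ x₁ x₂ y₁ y₂ x-partition y-partition =
    trans (refineˡ y₁ y₂ x₁ x₂ y-partition x-partition) (cong₂ _+_ (cong 𝟙 (∧-comm y₁ x₁)) (cong 𝟙 (∧-comm y₁ x₂)))

  module SubtreeTransfer {n : ℕ} {P P′ : ParentFn n} {s s′ : Fin n}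
    (s→s′ : P s ≡ just s′) (s′→s : P′ s′ ≡ just s) (same : SameContraction P P′ s s′) where

    open Ancestry P using (_≼_)
    open Ancestry P′ using () renaming (_≼_ to _≼′_)

    private
      col : Fin n → Fin n
      col = collapse s s′

    below-collapse : ∀ a → a ≼′ col a
    below-collapse a with eqF a s′ in e
    ... | false = ε
    ... | true with refl ← eqF-true e = s′→s ◅ ε

    merged-parent : ∀ (m m′ : Maybe (Fin n)) {y} → M.map col m ≡ M.map col m′ → m ≡ just y →
      ∃ λ z → m′ ≡ just z × col z ≡ col y
    merged-parent _ (just z) e refl = z , refl , sym (just-injective e)

    collapse-step : ∀ {a y} → P a ≡ just y → col a ≼′ col y
    collapse-step {a} {y} a→y with a ≟ s′ | a ≟ s
    ... | yes refl | _ with merged-parent (P a) (P′ s) (proj₂ same) a→y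
    ...   | z , s→z , z≡y = s→z ◅ subst (z ≼′_) z≡y (below-collapse z)
    collapse-step {a} {y} a→y | no a≢s′ | yes refl with just-injective (trans (sym s→s′) a→y)
    ...   | refl = subst (a ≼′_) (sym (collapse-s′ {s = a} {y})) ε
    collapse-step {a} {y} a→y | no a≢s′ | no a≢s with merged-parent (P a) (P′ a) (proj₁ same a a≢s a≢s′) a→y
    ...   | z , a→z , z≡y = a→z ◅ subst (z ≼′_) z≡y (below-collapse z)

    collapse-monotone : ∀ {a x} → a ≼ x → col a ≼′ col x
    collapse-monotone ε = ε
    collapse-monotone (a→y ◅ y≼x) = collapse-step a→y ◅◅ collapse-monotone y≼x

    subtree-transfer : ∀ {a x} → a ≼ x → a ≼′ col x
    subtree-transfer {a} a≼x = below-collapse a ◅◅ collapse-monotone a≼x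

  -- Δ(T, T′) = Δℕ δ_S δ_S′ δ_R δ_R′ + π_R′ − π_R.
  Δℕ : ℕ → ℕ → ℕ → ℕ → ℕ
  Δℕ x y r r′ = (x + 1) * (y + 1) + r′ * (x + y + r + 2)

  Δℕ-sym : ∀ x y r r′ → Δℕ y x r r′ ≡ Δℕ x y r r′
  Δℕ-sym = unfolded
    where
      unfolded : ∀ x y r r′ → (y + 1) * (x + 1) + r′ * (y + x + r + 2) ≡ (x + 1) * (y + 1) + r′ * (x + y + r + 2)
      unfolded = solve-∀

  -- count-A and count-B are the path-count identities at one vertex of the flipped edge, before and
  -- after the flip; subtracting them, 2 (B − A) = c² − a² − b² + q_R − q_R′ = 2 Δ + 2 π_R′ − 2 π_R.
  Δ-from-path-counts : ∀ {x y r r′ a b c A B q qR qR′ πR πR′} →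
    a ≡ 1 + (x + r) → b ≡ 1 + (y + r) → c ≡ 1 + (b + x + r′) →
    2 * A + (q + qR) ≡ a * a + 1 →
    2 * B + (b * b + q + qR′) ≡ c * c + 1 →
    2 * πR + qR ≡ r * r → 2 * πR′ + qR′ ≡ r′ * r′ →
    B + πR ≡ A + (Δℕ x y r r′ + πR′)
  Δ-from-path-counts {x} {y} {r} {r′} {A = A} {B} {q} {qR} {qR′} {πR} {πR′} refl refl refl count-A count-B π-R π-R′ =
    *-cancelˡ-≡ _ _ 2 (+-cancelʳ-≡ K _ _ (begin
      2 * (B + πR) + K
        ≡⟨ regroupᴮ B πR b² q qR qR′ ⟩
      (2 * B + (b² + q + qR′)) + (2 * πR + qR)
        ≡⟨ cong₂ _+_ count-B π-R ⟩
      (c * c + 1) + r * r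
        ≡⟨ squares x y r r′ ⟩
      (a * a + 1) + r′ * r′ + (b² + 2 * Δℕ x y r r′)
        ≡⟨ sym (cong₂ (λ u v → u + v + (b² + 2 * Δℕ x y r r′)) count-A π-R′) ⟩
      (2 * A + (q + qR)) + (2 * πR′ + qR′) + (b² + 2 * Δℕ x y r r′)
        ≡⟨ regroupᴬ A (Δℕ x y r r′) πR′ b² q qR qR′ ⟩
      2 * (A + (Δℕ x y r r′ + πR′)) + K ∎))
    where
      open ≡-Reasoning
      a = 1 + (x + r)
      b = 1 + (y + r)
      c = 1 + (b + x + r′)
      b² = b * b
      K = b² + q + qR′ + qR
      regroupᴮ : ∀ B πR b² q qR qR′ → 2 * (B + πR) + (b² + q + qR′ + qR) ≡ (2 * B + (b² + q + qR′)) + (2 * πR + qR)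
      regroupᴮ = solve-∀
      regroupᴬ : ∀ A X πR′ b² q qR qR′ →
        (2 * A + (q + qR)) + (2 * πR′ + qR′) + (b² + 2 * X) ≡ 2 * (A + (X + πR′)) + (b² + q + qR′ + qR)
      regroupᴬ = solve-∀
      squares : ∀ x y r r′ →
        (1 + ((1 + (y + r)) + x + r′)) * (1 + ((1 + (y + r)) + x + r′)) + 1 + r * r ≡
        ((1 + (x + r)) * (1 + (x + r)) + 1) + r′ * r′ +
        ((1 + (y + r)) * (1 + (y + r)) + 2 * ((x + 1) * (y + 1) + r′ * (x + y + r + 2)))
      squares = solve-∀

  ℕ-difference : ∀ a b c d → a + d ≡ b + c → ℤ.+ a ℤ.- ℤ.+ b ≡ ℤ.+ c ℤ.- ℤ.+ d
  ℕ-difference a b c d a+d≡b+c = begin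
    ℤ.+ a ℤ.- ℤ.+ b                                 ≡⟨ shift (ℤ.+ a) (ℤ.+ b) (ℤ.+ d) ⟩
    (ℤ.+ a ℤ.+ ℤ.+ d) ℤ.- (ℤ.+ b ℤ.+ ℤ.+ d)         ≡⟨ cong (ℤ._- (ℤ.+ b ℤ.+ ℤ.+ d)) (sym (ℤ.pos-+ a d)) ⟩
    ℤ.+ (a + d) ℤ.- (ℤ.+ b ℤ.+ ℤ.+ d)               ≡⟨ cong (λ m → ℤ.+ m ℤ.- (ℤ.+ b ℤ.+ ℤ.+ d)) a+d≡b+c ⟩
    ℤ.+ (b + c) ℤ.- (ℤ.+ b ℤ.+ ℤ.+ d)               ≡⟨ cong (ℤ._- (ℤ.+ b ℤ.+ ℤ.+ d)) (ℤ.pos-+ b c) ⟩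
    (ℤ.+ b ℤ.+ ℤ.+ c) ℤ.- (ℤ.+ b ℤ.+ ℤ.+ d)         ≡⟨ cancel (ℤ.+ b) (ℤ.+ c) (ℤ.+ d) ⟩
    ℤ.+ c ℤ.- ℤ.+ d                                 ∎
    where
      open ≡-Reasoning
      shift : ∀ x y z → x ℤ.- y ≡ (x ℤ.+ z) ℤ.- (y ℤ.+ z)
      shift = ℤ-solve-∀
      cancel : ∀ x y z → (x ℤ.+ y) ℤ.- (x ℤ.+ z) ≡ y ℤ.- z
      cancel = ℤ-solve-∀

  module Contraction {n : ℕ} {P P′ : ParentFn n} (acyclic : Acyclic P) (acyclic′ : Acyclic P′)
    {s s′ : Fin n} (s≢s′ : s ≢ s′) (s→s′ : P s ≡ just s′) (s′→s : P′ s′ ≡ just s)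
    (same : SameContraction P P′ s s′) where

    module T = Forest acyclic
    module T′ = Forest acyclic′
    open SubtreeTransfer {P = P} {P′} s→s′ s′→s same using (subtree-transfer)
    open SubtreeTransfer {P = P′} {P} s′→s s→s′ (SameContraction-sym {P = P} {P′} same) using ()
      renaming (subtree-transfer to subtree-transfer′)

    s′≢s : s′ ≢ s
    s′≢s = s≢s′ ∘ sym

    D-transfer : ∀ {x} → x ≢ s → D P x ≡ D P′ (collapse s s′ x)
    D-transfer {x} x≢s = tabulate-cong λ a → ≡true-ext
      (λ a∈Dx → T′.≼⇒isDesc (subtree-transfer (T.isDesc⇒≼ a∈Dx)))
      (λ a∈D′x → T.≼⇒isDesc (subst (a T.≼_) back (subtree-transfer′ (T′.isDesc⇒≼ a∈D′x))))
      where
        back : collapse s′ s (collapse s s′ x) ≡ x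
        back = trans (collapse-back x) (collapse-≢ x≢s)

    ∣D∣-transfer : ∀ {x} → x ≢ s → x ≢ s′ → ∣ D P x ∣ ≡ ∣ D P′ x ∣
    ∣D∣-transfer x≢s x≢s′ = cong ∣_∣ (trans (D-transfer x≢s) (cong (D P′) (collapse-≢ x≢s′)))

    ∣D∣-transfer-s′ : ∣ D P s′ ∣ ≡ ∣ D P′ s ∣
    ∣D∣-transfer-s′ = cong ∣_∣ (trans (D-transfer s′≢s) (cong (D P′) (collapse-s′ {s = s} {s′})))

    S S′ R R′ : Subset n
    S = ChildSet P P′ s s
    S′ = ChildSet P P′ s′ s′
    R = ChildSet P P′ s s′
    R′ = ChildSet P P′ s′ s

    ∣D∣ ∣D′∣ ∣D∣² ∣D′∣² : Fin n → ℕ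
    ∣D∣ c = ∣ D P c ∣
    ∣D′∣ c = ∣ D P′ c ∣
    ∣D∣² c = ∣ D P c ∣ * ∣ D P c ∣
    ∣D′∣² c = ∣ D P′ c ∣ * ∣ D P′ c ∣

    Agree : (Fin n → ℕ) → (Fin n → ℕ) → Set
    Agree w w′ = ∀ c → c ≢ s → c ≢ s′ → w c ≡ w′ c

    agree-∣D∣ : Agree ∣D∣ ∣D′∣
    agree-∣D∣ c c≢s c≢s′ = ∣D∣-transfer c≢s c≢s′

    agree-∣D∣² : Agree ∣D∣² ∣D′∣²
    agree-∣D∣² c c≢s c≢s′ = cong (λ m → m * m) (∣D∣-transfer c≢s c≢s′)

    ch ch′ : Fin n → Fin n → Bool
    ch c v = isChild P c v
    ch′ c v = isChild P′ c v

    ch-s-s : ch s s ≡ false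
    ch-s-s = not-child P λ s→s → s≢s′ (just-injective (trans (sym s→s) s→s′))

    ch-s-s′ : ch s s′ ≡ true
    ch-s-s′ = just-eqMF s→s′

    ch-s′-s : ch s′ s ≡ false
    ch-s′-s = not-child P λ s′→s → T.no-cycle s′→s (s→s′ ◅ ε)

    ch-s′-s′ : ch s′ s′ ≡ false
    ch-s′-s′ = not-child P λ s′→s′ → T.no-cycle s′→s′ ε

    ch′-s-s : ch′ s s ≡ false
    ch′-s-s = not-child P′ λ s→s → T′.no-cycle s→s ε

    ch′-s-s′ : ch′ s s′ ≡ false
    ch′-s-s′ = not-child P′ λ s→s′ → T′.no-cycle s→s′ (s′→s ◅ ε)

    ch′-s′-s : ch′ s′ s ≡ true
    ch′-s′-s = just-eqMF s′→s

    ch′-s′-s′ : ch′ s′ s′ ≡ false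
    ch′-s′-s′ = not-child P′ λ s′→s′ → s≢s′ (just-injective (trans (sym s′→s) s′→s′))

    ch-s-other : ∀ {t} → t ≢ s′ → ch s t ≡ false
    ch-s-other t≢s′ = not-child P λ s→t → t≢s′ (just-injective (trans (sym s→t) s→s′))

    ch′-s′-other : ∀ {t} → t ≢ s → ch′ s′ t ≡ false
    ch′-s′-other t≢s = not-child P′ λ s′→t → t≢s (just-injective (trans (sym s′→t) s′→s))

    partition : ∀ {c} → c ≢ s → c ≢ s′ →
      𝟙 (ch c s) + 𝟙 (ch c s′) ≡ 𝟙 (eqMF (M.map (collapse s s′) (P c)) s)
    partition {c} _ _ = 𝟙-merged s≢s′ (P c)

    partition′ : ∀ {c} → c ≢ s → c ≢ s′ →
      𝟙 (ch′ c s) + 𝟙 (ch′ c s′) ≡ 𝟙 (eqMF (M.map (collapse s s′) (P c)) s)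
    partition′ {c} c≢s c≢s′ =
      trans (𝟙-merged s≢s′ (P′ c)) (cong (λ m → 𝟙 (eqMF m s)) (sym (proj₁ same c c≢s c≢s′)))

    lookup-ChildSet : ∀ a b c → lookup (ChildSet P P′ a b) c ≡ ch c a ∧ ch′ c b
    lookup-ChildSet a b = lookup∘tabulate (λ x → isChild P x a ∧ isChild P′ x b)

    children-s : ∀ c → 𝟙 (ch c s) ≡ 𝟙 (lookup S c) + 𝟙 (lookup R c)
    children-s c rewrite lookup-ChildSet s s c | lookup-ChildSet s s′ c with c ≟ s | c ≟ s′
    ... | yes refl | _ rewrite ch-s-s = refl
    ... | no _ | yes refl rewrite ch-s′-s = refl
    ... | no c≢s | no c≢s′ = refineˡ (ch c s) (ch c s′) (ch′ c s) (ch′ c s′) (partition c≢s c≢s′) (partition′ c≢s c≢s′)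

    children-s′ : ∀ c → 𝟙 (ch c s′) ≡ 𝟙 (eqF s c) + 𝟙 (lookup S′ c) + 𝟙 (lookup R′ c)
    children-s′ c rewrite lookup-ChildSet s′ s′ c | lookup-ChildSet s′ s c with c ≟ s | c ≟ s′
    ... | yes refl | _ rewrite ch-s-s′ | ch′-s-s′ | ch′-s-s | eqF-refl s = refl
    ... | no _ | yes refl rewrite ch-s′-s′ | eqF-≢ s≢s′ = refl
    ... | no c≢s | no c≢s′ rewrite eqF-≢ (c≢s ∘ sym) =
      refineˡ (ch c s′) (ch c s) (ch′ c s′) (ch′ c s)
        (trans (+-comm (𝟙 (ch c s′)) _) (partition c≢s c≢s′)) (trans (+-comm (𝟙 (ch′ c s′)) _) (partition′ c≢s c≢s′))

    children′-s′ : ∀ c → 𝟙 (ch′ c s′) ≡ 𝟙 (lookup S′ c) + 𝟙 (lookup R c)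
    children′-s′ c rewrite lookup-ChildSet s′ s′ c | lookup-ChildSet s s′ c with c ≟ s | c ≟ s′
    ... | yes refl | _ rewrite ch′-s-s′ | ch-s-s | ch-s-s′ = refl
    ... | no _ | yes refl rewrite ch′-s′-s′ | ch-s′-s′ | ch-s′-s = refl
    ... | no c≢s | no c≢s′ = refineʳ (ch c s′) (ch c s) (ch′ c s′) (ch′ c s)
        (trans (+-comm (𝟙 (ch c s′)) _) (partition c≢s c≢s′)) (trans (+-comm (𝟙 (ch′ c s′)) _) (partition′ c≢s c≢s′))

    children′-s : ∀ c → 𝟙 (ch′ c s) ≡ 𝟙 (eqF s′ c) + 𝟙 (lookup S c) + 𝟙 (lookup R′ c)
    children′-s c rewrite lookup-ChildSet s s c | lookup-ChildSet s′ s c with c ≟ s | c ≟ s′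
    ... | yes refl | _ rewrite ch′-s-s | ch-s-s | ch-s-s′ | eqF-≢ s′≢s = refl
    ... | no _ | yes refl rewrite ch′-s′-s | ch-s′-s | ch-s′-s′ | eqF-refl s′ = refl
    ... | no c≢s | no c≢s′ rewrite eqF-≢ (c≢s′ ∘ sym) =
      refineʳ (ch c s) (ch c s′) (ch′ c s) (ch′ c s′) (partition c≢s c≢s′) (partition′ c≢s c≢s′)

    sumWhere-ChildSet-transfer : ∀ a b → ch s′ a ≡ false → ch′ s b ≡ false →
      (w w′ : Fin n → ℕ) → Agree w w′ →
      sumWhere (lookup (ChildSet P P′ a b)) w ≡ sumWhere (lookup (ChildSet P P′ a b)) w′
    sumWhere-ChildSet-transfer a b s′∉a s∉b w w′ w≡w′ = sumFin-cong term
      where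
        term : ∀ c → (if lookup (ChildSet P P′ a b) c then w c else 0) ≡ (if lookup (ChildSet P P′ a b) c then w′ c else 0)
        term c with c ≟ s | c ≟ s′
        ... | yes refl | _ rewrite lookup-ChildSet a b c | s∉b | ∧-zeroʳ (ch c a) = refl
        ... | no _ | yes refl rewrite lookup-ChildSet a b c | s′∉a = refl
        ... | no c≢s | no c≢s′ = cong (if lookup (ChildSet P P′ a b) c then_else 0) (w≡w′ c c≢s c≢s′)

    childSum-transfer-other : ∀ {t} → t ≢ s → t ≢ s′ → (w w′ : Fin n → ℕ) →
      Agree w w′ → w s′ ≡ w′ s → childSum P t w ≡ childSum P′ t w′
    childSum-transfer-other {t} t≢s t≢s′ w w′ w≡w′ ws′≡w′s =
      trans (sumFin-cong term) (sym (sumFin-transpose s s′ (λ c → if ch′ c t then w′ c else 0)))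
      where
        -- Exchanging s and s′ matches the children of t in T with those in T′.
        term : ∀ c → (if ch c t then w c else 0) ≡ (if ch′ (PC.transpose s s′ c) t then w′ (PC.transpose s s′ c) else 0)
        term c with c ≟ s
        ... | yes refl rewrite ch-s-other t≢s′ | ch′-s′-other t≢s = refl
        ... | no c≢s with c ≟ s′
        ...   | yes refl =
          cong₂ (if_then_else 0) (isChild-collapse (P s′) (P′ s) (proj₂ same) t≢s t≢s′) ws′≡w′s
        ...   | no c≢s′ =
          cong₂ (if_then_else 0) (isChild-collapse (P c) (P′ c) (proj₁ same c c≢s c≢s′) t≢s t≢s′) (w≡w′ c c≢s c≢s′)

    p-other : ∀ {t} → t ≢ s → t ≢ s′ → p P′ t ≡ p P t
    p-other {t} t≢s t≢s′ = *-cancelˡ-≡ (p P′ t) (p P t) 2 (+-cancelʳ-≡ C (2 * p P′ t) (2 * p P t) (begin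
      2 * p P′ t + C
        ≡⟨ cong (2 * p P′ t +_) (childSum-transfer-other t≢s t≢s′ ∣D∣² ∣D′∣² agree-∣D∣² (cong (λ m → m * m) ∣D∣-transfer-s′)) ⟩
      2 * p P′ t + childSum P′ t ∣D′∣²
        ≡⟨ T′.path-count t ⟩
      ∣ D P′ t ∣ * ∣ D P′ t ∣ + 1
        ≡⟨ cong (λ m → m * m + 1) (sym (∣D∣-transfer t≢s t≢s′)) ⟩
      ∣ D P t ∣ * ∣ D P t ∣ + 1
        ≡⟨ sym (T.path-count t) ⟩
      2 * p P t + C ∎))
      where
        open ≡-Reasoning
        C = childSum P t ∣D∣²

    childSum-s : ∀ w → childSum P s w ≡ sumWhere (lookup S) w + sumWhere (lookup R) w
    childSum-s w = sumWhere-split w children-s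

    childSum-s′ : ∀ w → childSum P s′ w ≡ w s + sumWhere (lookup S′) w + sumWhere (lookup R′) w
    childSum-s′ w = trans (sumWhere-split₃ w children-s′)
      (cong (λ m → m + sumWhere (lookup S′) w + sumWhere (lookup R′) w) (sumFin-δ s w))

    childSum′-s′ : ∀ w w′ → Agree w w′ → childSum P′ s′ w′ ≡ sumWhere (lookup S′) w + sumWhere (lookup R) w
    childSum′-s′ w w′ agree = trans (sumWhere-split w′ children′-s′) (sym (cong₂ _+_
      (sumWhere-ChildSet-transfer s′ s′ ch-s′-s′ ch′-s-s′ w w′ agree)
      (sumWhere-ChildSet-transfer s s′ ch-s′-s ch′-s-s′ w w′ agree)))

    childSum′-s : ∀ w w′ → Agree w w′ → childSum P′ s w′ ≡ w′ s′ + sumWhere (lookup S) w + sumWhere (lookup R′) w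
    childSum′-s w w′ agree = trans (sumWhere-split₃ w′ children′-s) (cong₂ _+_
      (cong₂ _+_ (sumFin-δ s′ w′) (sym (sumWhere-ChildSet-transfer s s ch-s′-s ch′-s-s w w′ agree)))
      (sym (sumWhere-ChildSet-transfer s′ s ch-s′-s′ ch′-s-s w w′ agree)))

    squares : Subset n → ℕ
    squares X = sumWhere (lookup X) ∣D∣²

    count-s : 2 * p P s + (squares S + squares R) ≡ ∣D∣² s + 1
    count-s = trans (cong (2 * p P s +_) (sym (childSum-s ∣D∣²))) (T.path-count s)

    count-s′ : 2 * p P s′ + (∣D∣² s + squares S′ + squares R′) ≡ ∣D∣² s′ + 1
    count-s′ = trans (cong (2 * p P s′ +_) (sym (childSum-s′ ∣D∣²))) (T.path-count s′)

    count′-s′ : 2 * p P′ s′ + (squares S′ + squares R) ≡ ∣D′∣² s′ + 1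
    count′-s′ = trans (cong (2 * p P′ s′ +_) (sym (childSum′-s′ ∣D∣² ∣D′∣² agree-∣D∣²))) (T′.path-count s′)

    count′-s : 2 * p P′ s + (∣D′∣² s′ + squares S + squares R′) ≡ ∣D′∣² s + 1
    count′-s = trans (cong (2 * p P′ s +_) (sym (childSum′-s ∣D∣² ∣D′∣² agree-∣D∣²))) (T′.path-count s)

    size-s : ∣D∣ s ≡ 1 + (δ P S + δ P R)
    size-s = trans (T.subtree-size s) (cong (1 +_) (childSum-s ∣D∣))

    size-s′ : ∣D∣ s′ ≡ 1 + (∣D∣ s + δ P S′ + δ P R′)
    size-s′ = trans (T.subtree-size s′) (cong (1 +_) (childSum-s′ ∣D∣))

    size′-s′ : ∣D′∣ s′ ≡ 1 + (δ P S′ + δ P R)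
    size′-s′ = trans (T′.subtree-size s′) (cong (1 +_) (childSum′-s′ ∣D∣ ∣D′∣ agree-∣D∣))

    size′-s : ∣D′∣ s ≡ 1 + (∣D′∣ s′ + δ P S + δ P R′)
    size′-s = trans (T′.subtree-size s) (cong (1 +_) (childSum′-s ∣D∣ ∣D′∣ agree-∣D∣))

    Δ-core : ℕ
    Δ-core = Δℕ (δ P S) (δ P S′) (δ P R) (δ P R′)

    p-at-s : p P′ s + π P R ≡ p P s + (Δ-core + π P R′)
    p-at-s = Δ-from-path-counts {A = p P s} {p P′ s} {squares S} {squares R} {squares R′} {π P R} {π P R′}
      size-s size′-s′ size′-s count-s count′-s (δ²≡2π+squares P R) (δ²≡2π+squares P R′)

    p-at-s′ : p P s′ + π P R ≡ p P′ s′ + (Δ-core + π P R′)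
    p-at-s′ = trans
      (Δ-from-path-counts {A = p P′ s′} {p P s′} {squares S′} {squares R} {squares R′} {π P R} {π P R′}
        size′-s′ size-s size-s′ count′-s′ count-s′ (δ²≡2π+squares P R) (δ²≡2π+squares P R′))
      (cong (λ m → p P′ s′ + (m + π P R′)) (Δℕ-sym (δ P S) (δ P S′) (δ P R) (δ P R′)))

    p-flip : ∀ t → ℤ.+ p P′ t ℤ.- ℤ.+ p P t ≡ Δ P P′ s s′ ℤ.* eDiff s s′ t
    p-flip t with t ≟ s | t ≟ s′
    ... | yes refl | _ =
      trans (ℕ-difference (p P′ s) (p P s) (Δ-core + π P R′) (π P R) p-at-s) (sym (ℤ.*-identityʳ _))
    ... | no _ | yes refl =
      trans (ℕ-difference (p P′ s′) (p P s′) (π P R) (Δ-core + π P R′) (sym p-at-s′))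
            (negate (ℤ.+ (Δ-core + π P R′)) (ℤ.+ π P R))
      where
        negate : ∀ x y → y ℤ.- x ≡ (x ℤ.- y) ℤ.* ℤ.-[1+ 0 ]
        negate = ℤ-solve-∀
    ... | no t≢s | no t≢s′ = trans (cong (λ m → ℤ.+ m ℤ.- ℤ.+ p P t) (p-other t≢s t≢s′))
      (trans (ℤ.+-inverseʳ (ℤ.+ p P t)) (sym (ℤ.*-zeroʳ (Δ P P′ s s′))))

open import Defs
open import Data.Fin using (Fin)
open import Data.Fin.Subset using (Subset)
open import Data.Maybe using (just)
open import Data.Integer using (+_; _-_; _*_)
open import Data.Product using (_,_)
open import Relation.Binary.PropositionalEquality using (_≡_; _≢_)

lemma3p3 : ∀ {n} (B : Subset n → Set) → IsBuildingSet B → IsConnected B →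
    (P P' : ParentFn n) → IsMaximalBTree B P → IsMaximalBTree B P' →
    (s s' : Fin n) → s ≢ s' → P s ≡ just s' → P' s' ≡ just s →
    SameContraction P P' s s' →
    ∀ t → (+ p P' t) - (+ p P t) ≡ Δ P P' s s' * eDiff s s' t
lemma3p3 _ _ _ P P' ((acyclic , _) , _) ((acyclic' , _) , _) s s' s≢s' s→s' s'→s same =
  PathCounts.Contraction.p-flip acyclic acyclic' s≢s' s→s' s'→s same
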